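{- Let $A(n)$ denote the minimum size of a propagation complete encoding of $\mathrm{AMO}_n$, $E(n)$ the minimum size of a propagation complete encoding of $\mathrm{EO}_n$, and $S(n)$ the minimum size of a P-encoding with $n$ input variables. Then $A(2)=1$, $E(2)=2$, $S(2)=1$, $A(3)=3$, $E(3)=4$, $S(3)=3$.
   Context: A CNF formula is a conjunction of clauses (disjunctions of literals with no complementary pair); its size is its number of clauses. Unit resolution: from a unit clause $l$ and a clause containing $\neg l$ derive the clause with $\neg l$ removed; $\varphi\wedge g_1\wedge\dots\wedge g_p\vdash_1 C$ means $C$ is derivable from $\varphi$ and the unit clauses $g_i$ by a sequence of unit resolutions, $\vdash_1\bot$ means the empty clause is derivable. $\mathrm{AMO}_n(x_1,\dots,x_n)=1$ iff at most one $x_i$ is $1$; $\mathrm{EO}_n(x_1,\dots,x_n)=1$ iff exactly one $x_i$ is $1$. A CNF $\varphi(\mathbf{x},\mathbf{y})$ with input variables $\mathbf{x}=(x_1,\dots,x_n)$ and auxiliary variables $\mathbf{y}=(y_1,\dots,y_\ell)$ ($\ell\ge0$) is an encoding of $f(\mathbf{x})$ if for all $\alpha\in\{0,1\}^n$: $f(\alpha)=1$ iff $\exists\beta\in\{0,1\}^\ell$, $\varphi(\alpha,\beta)=1$; it is a propagation complete encoding if moreover for all literals $g_1,\dots,g_p$ ($p\ge1$) and $h$ on input variables with $f\wedge\bigwedge_i g_i\models h$, we have $\varphi\wedge\bigwedge_i g_i\vdash_1 h$ or $\varphi\wedge\bigwedge_i g_i\vdash_1\bot$. $\varphi(\mathbf{x},\mathbf{y})$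 is a P-encoding if (P1) $\varphi\wedge x_i$ is satisfiable for each $i$ and (P2) $\varphi\wedge x_i\vdash_1\neg x_j$ for all $i\ne j$. -}

module Defs where

open import Data.Nat using (ℕ; _≤_)
open import Data.Fin using (Fin)
open import Data.Bool using (Bool; true; false; not)
open import Data.Sum using (_⊎_; inj₁; inj₂)
open import Data.Product using (_×_; Σ; ∃; ∃-syntax; _,_)
open import Data.List using (List; []; _∷_; length; map)
open import Data.List.Membership.Propositional using (_∈_)
open import Data.List.Relation.Unary.All using (All)
open import Data.List.Relation.Unary.Any using (Any)
open import Relation.Binary.PropositionalEquality using (_≡_; _≢_)
open import Relation.Nullary using (¬_)
open import Function.Bundles using (_⇔_)

-- Syntax of CNF formulas
-- Variables: n input variables (inj₁) and ℓ auxiliary variables (inj₂).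

Var : ℕ → ℕ → Set
Var n ℓ = Fin n ⊎ Fin ℓ

-- A literal over a set of variables V: (v , true) is v, (v , false) is ¬v.
Lit : Set → Set
Lit V = V × Bool

neg : ∀ {V : Set} → Lit V → Lit V
neg (v , b) = (v , not b)

-- Clauses are lists of literals (read as the set of their members).
Clause : Set → Set
Clause V = List (Lit V)

NoCompl : ∀ {V : Set} → Clause V → Set
NoCompl C = ∀ l → l ∈ C → ¬ (neg l ∈ C)

CNF : ℕ → ℕ → Set
CNF n ℓ = List (Clause (Var n ℓ))

size : ∀ {n ℓ} → CNF n ℓ → ℕ
size = length

WellFormed : ∀ {n ℓ} → CNF n ℓ → Set
WellFormed φ = All NoCompl φ

LitTrue : ∀ {V : Set} → (V → Bool) → Lit V → Set
LitTrue a (v , b) = a v ≡ b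

ClauseSat : ∀ {V : Set} → (V → Bool) → Clause V → Set
ClauseSat a C = Any (LitTrue a) C

CNFSat : ∀ {n ℓ} → (Var n ℓ → Bool) → CNF n ℓ → Set
CNFSat a φ = All (ClauseSat a) φ

_⊕_ : ∀ {n ℓ} → (Fin n → Bool) → (Fin ℓ → Bool) → Var n ℓ → Bool
(α ⊕ β) (inj₁ i) = α i
(α ⊕ β) (inj₂ j) = β j

BoolFun : ℕ → Set₁
BoolFun n = (Fin n → Bool) → Set

AMO : ∀ n → BoolFun n
AMO n α = ∀ (i j : Fin n) → α i ≡ true → α j ≡ true → i ≡ j

EO : ∀ n → BoolFun n
EO n α = AMO n α × (∃[ i ] α i ≡ true)

-- Derives S C : clause C is derivable from the clause set S by a
-- sequence of unit resolutions (clauses are compared as sets).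
data Derives {V : Set} (S : List (Clause V)) : Clause V → Set where
  axiom : ∀ {C} → C ∈ S → Derives S C
  resolve : ∀ {U D E} (l : Lit V)
          → Derives S U → (∀ x → (x ∈ U) ⇔ (x ≡ l))
          → Derives S D → neg l ∈ D
          → (∀ x → (x ∈ E) ⇔ ((x ∈ D) × (x ≢ neg l)))
          → Derives S E

liftLit : ∀ {n ℓ} → Lit (Fin n) → Lit (Var n ℓ)
liftLit (i , b) = (inj₁ i , b)

unit : ∀ {V : Set} → Lit V → Clause V
unit l = l ∷ []

withUnits : ∀ {n ℓ} → CNF n ℓ → List (Lit (Fin n)) → CNF n ℓ
withUnits {n} {ℓ} φ gs = Data.List._++_ φ (map (λ g → unit (liftLit {n} {ℓ} g)) gs)

⊢₁lit : ∀ {n ℓ} → CNF n ℓ → List (Lit (Fin n)) → Lit (Fin n) → Set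
⊢₁lit {n} {ℓ} φ gs h =
  ∃[ E ] (Derives (withUnits φ gs) E × (∀ x → (x ∈ E) ⇔ (x ≡ liftLit {n} {ℓ} h)))

⊢₁⊥ : ∀ {n ℓ} → CNF n ℓ → List (Lit (Fin n)) → Set
⊢₁⊥ φ gs = Derives (withUnits φ gs) []

IsEncoding : ∀ {n ℓ} → BoolFun n → CNF n ℓ → Set
IsEncoding {n} {ℓ} f φ =
  ∀ (α : Fin n → Bool) → f α ⇔ (∃[ β ] CNFSat (α ⊕ β) φ)

Entails : ∀ {n} → BoolFun n → List (Lit (Fin n)) → Lit (Fin n) → Set
Entails f gs h = ∀ α → f α → All (LitTrue α) gs → LitTrue α h

IsPCEncoding : ∀ {n ℓ} → BoolFun n → CNF n ℓ → Set
IsPCEncoding {n} f φ =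
  IsEncoding f φ ×
  (∀ (gs : List (Lit (Fin n))) (h : Lit (Fin n)) → gs ≢ []
     → Entails f gs h → ⊢₁lit φ gs h ⊎ ⊢₁⊥ φ gs)

IsPEncoding : ∀ {n ℓ} → CNF n ℓ → Set
IsPEncoding {n} {ℓ} φ =
  (∀ (i : Fin n) → ∃[ a ] (CNFSat a φ × a (inj₁ i) ≡ true)) ×
  (∀ (i j : Fin n) → i ≢ j → ⊢₁lit φ ((i , true) ∷ []) (j , false))

IsMinSize : (n : ℕ) → (∀ {ℓ} → CNF n ℓ → Set) → ℕ → Set
IsMinSize n P k =
  (∃[ ℓ ] Σ (CNF n ℓ) (λ φ → WellFormed φ × P φ × size φ ≡ k)) ×
  (∀ (ℓ : ℕ) (φ : CNF n ℓ) → WellFormed φ → P φ → k ≤ size φ)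

A-is : ℕ → ℕ → Set
A-is n k = IsMinSize n (IsPCEncoding (AMO n)) k

E-is : ℕ → ℕ → Set
E-is n k = IsMinSize n (IsPCEncoding (EO n)) k

S-is : ℕ → ℕ → Set
S-is n k = IsMinSize n IsPEncoding k

-- Upper bounds.  The pairwise CNF  amoClauses n  (all clauses ¬xᵢ ∨ ¬xⱼ with
-- i < j) is a propagation complete encoding of AMOₙ and a P-encoding, and
-- adding the clause x₁ ∨ … ∨ xₙ gives one of EOₙ; this holds for every n.
-- Completeness is shown by a case analysis on the hypotheses: a positive
-- hypothesis xᵢ either meets a conflict or propagates every ¬xⱼ through the
-- pair clauses, and otherwise an entailment that is not derivable is refuted
-- by a unit vector eᵢ, which is a model of AMOₙ and EOₙ.
--
-- Lower bounds.  Take a model of φ that is eᵢ on the inputs.  Raising xⱼ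
-- (resp. lowering xᵢ for EO) yields a non-model, and the clause it falsifies
-- is a "blocking clause": it contains ¬xⱼ but no ¬xₖ for k ∉ {i, j} (resp. it
-- contains no negative input literal).  For three inputs the blocking clauses
-- of the pairs (2,0), (0,1), (1,2) are pairwise distinct, and for EO a clause
-- without negative input literal is a fourth; counting distinct members of
-- φ gives the lower bounds.
module Submission where

open import Defs
open import Data.Bool using (Bool; true; false)
open import Data.Bool.Properties using (not-¬) renaming (_≟_ to _≟ᴮ_)
open import Data.Empty using (⊥-elim)
open import Data.Fin using (Fin; zero; suc; _≟_; _<_; _<?_)
open import Data.Fin.Properties using (<⇒≢; <-cmp; all?; ¬∀⟶∃¬; injective⇒≤)
open import Data.List using (List; []; _∷_; length; map; filter; lookup; allFin; cartesianProduct)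
open import Data.List.Membership.Propositional using (_∈_; _∉_; find; lose)
open import Data.List.Membership.Propositional.Properties
  using (∈-map⁺; ∈-map⁻; ∈-filter⁺; ∈-filter⁻; ∈-allFin; ∈-lookup; ∈-cartesianProduct⁺)
open import Data.List.Relation.Unary.All using (All; []; _∷_; tabulate)
import Data.List.Relation.Unary.All as All
open import Data.List.Relation.Unary.All.Properties using (¬All⇒Any¬)
import Data.List.Relation.Unary.All.Properties as AllP
open import Data.List.Relation.Unary.Any using (Any; here; there; any?; satisfied)
import Data.List.Relation.Unary.Any as Any
import Data.List.Relation.Unary.Any.Properties as AnyP
open import Data.List.Relation.Unary.Unique.Propositional using (Unique)
open import Data.List.Relation.Unary.AllPairs using ([]; _∷_)
open import Data.Nat using (ℕ; suc; _≤_)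
open import Data.Product using (_×_; ∃-syntax; _,_; proj₁; proj₂; uncurry)
import Data.Product.Properties as ProdP
open import Data.Sum using (_⊎_; inj₁; inj₂; [_,_]′)
import Data.Sum.Properties as SumP
open import Data.Vec.Functional using (updateAt)
open import Data.Vec.Functional.Properties using (updateAt-updates; updateAt-minimal)
open import Function.Bundles using (_⇔_; mk⇔; Equivalence)
open import Function.Definitions using (Injective)
open import Relation.Binary.Definitions using (DecidableEquality; tri<; tri≈; tri>)
open import Relation.Binary.PropositionalEquality
open import Relation.Nullary using (¬_; Dec; does; yes; no; ¬?)
open import Relation.Nullary.Decidable using (_×-dec_; _→-dec_)

open Equivalence using (to; from)

_≟ⱽ_ : ∀ {n ℓ} → DecidableEquality (Var n ℓ)
_≟ⱽ_ = SumP.≡-dec _≟_ _≟_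

_≟ᴸ_ : ∀ {n ℓ} → DecidableEquality (Lit (Var n ℓ))
_≟ᴸ_ = ProdP.≡-dec _≟ⱽ_ _≟ᴮ_

_≟ᴳ_ : ∀ {n} → DecidableEquality (Lit (Fin n))
_≟ᴳ_ = ProdP.≡-dec _≟_ _≟ᴮ_

_∈ᴳ?_ : ∀ {n} (g : Lit (Fin n)) (gs : List (Lit (Fin n))) → Dec (g ∈ gs)
g ∈ᴳ? gs = any? (g ≟ᴳ_) gs

posLit negLit : ∀ {n ℓ} → Fin n → Lit (Var n ℓ)
posLit i = (inj₁ i , true)
negLit i = (inj₁ i , false)

posLit-injective : ∀ {n ℓ} {i j : Fin n} → posLit {ℓ = ℓ} i ≡ posLit j → i ≡ j
posLit-injective refl = refl

negLit-injective : ∀ {n ℓ} {i j : Fin n} → negLit {ℓ = ℓ} i ≡ negLit j → i ≡ j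
negLit-injective refl = refl

litTrue-neg : ∀ {V : Set} (a : V → Bool) (l : Lit V) → LitTrue a l → ¬ LitTrue a (neg l)
litTrue-neg a (v , b) p q = not-¬ refl (trans (sym p) q)

sound : ∀ {V : Set} {S : List (Clause V)} {C : Clause V} (a : V → Bool) →
        All (ClauseSat a) S → Derives S C → ClauseSat a C
sound a sat (axiom C∈S) = All.lookup sat C∈S
sound a sat (resolve l u u≈l d negl∈D e≈) with find (sound a sat u) | find (sound a sat d)
... | x , x∈U , x-true | y , y∈D , y-true = lose (from (e≈ y) (y∈D , y≢negl)) y-true
  where
  y≢negl : y ≢ neg l
  y≢negl y≡negl = litTrue-neg a l (subst (LitTrue a) (to (u≈l x) x∈U) x-true)
                                  (subst (LitTrue a) y≡negl y-true)

sound-⊢₁ : ∀ {n ℓ} (a : Var n ℓ → Bool) (φ : CNF n ℓ) (gs : List (Lit (Fin n))) h →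
           CNFSat a φ → All (λ g → LitTrue a (liftLit {n} {ℓ} g)) gs →
           ⊢₁lit φ gs h → LitTrue a (liftLit {n} {ℓ} h)
sound-⊢₁ a φ gs h sat gs-true (E , d , E≈h)
  with find (sound a (AllP.++⁺ sat (AllP.map⁺ (All.map here gs-true))) d)
... | x , x∈E , x-true = subst (LitTrue a) (to (E≈h x) x∈E) x-true

module UnitResolution {V : Set} (_≟ˡ_ : DecidableEquality (Lit V)) (S : List (Clause V)) where

  DerivesUnit : Lit V → Set
  DerivesUnit l = ∃[ E ] (Derives S E × (∀ x → (x ∈ E) ⇔ (x ≡ l)))

  unit-axiom : ∀ {l} → (l ∷ []) ∈ S → DerivesUnit l
  unit-axiom {l} l∈S = l ∷ [] , axiom l∈S , λ x → mk⇔ (λ { (here x≡l) → x≡l ; (there ()) }) here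

  conflict : ∀ {l} → DerivesUnit l → DerivesUnit (neg l) → Derives S []
  conflict {l} (U , u , U≈l) (D , d , D≈negl) =
    resolve l u U≈l d (from (D≈negl _) refl)
      (λ x → mk⇔ (λ ()) (λ (x∈D , x≢negl) → ⊥-elim (x≢negl (to (D≈negl x) x∈D))))

  resolve-unit : ∀ {l D} → DerivesUnit l → Derives S D → neg l ∈ D →
                 ∃[ E ] (Derives S E × (∀ x → (x ∈ E) ⇔ (x ∈ D × x ≢ neg l)))
  resolve-unit {l} {D} (U , u , U≈l) d negl∈D = remaining , resolve l u U≈l d negl∈D remaining≈ , remaining≈
    where
    remaining : Clause V
    remaining = filter (λ x → ¬? (x ≟ˡ neg l)) D

    remaining≈ : ∀ x → (x ∈ remaining) ⇔ (x ∈ D × x ≢ neg l)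
    remaining≈ x = mk⇔ (∈-filter⁻ (λ y → ¬? (y ≟ˡ neg l))) (uncurry (∈-filter⁺ (λ y → ¬? (y ≟ˡ neg l))))

  strip : ∀ L {D} → All DerivesUnit L → Derives S D →
          ∃[ E ] (Derives S E × (∀ x → (x ∈ E) ⇔ (x ∈ D × All (λ m → x ≢ neg m) L)))
  strip [] [] d = _ , d , λ x → mk⇔ (_, []) proj₁
  strip (m ∷ L) (um ∷ uL) d with strip L uL d
  ... | E , e , E≈ with any? (neg m ≟ˡ_) E
  ...   | no negm∉E = E , e , λ x → mk⇔
          (λ x∈E → let x∈D , x-ok = to (E≈ x) x∈E
                   in x∈D , (λ { refl → negm∉E x∈E }) ∷ x-ok)
          (λ { (x∈D , _ ∷ x-ok) → from (E≈ x) (x∈D , x-ok) })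
  ...   | yes negm∈E with resolve-unit um e negm∈E
  ...     | E′ , e′ , E′≈ = E′ , e′ , λ x → mk⇔
          (λ x∈E′ → let x∈E , x≢negm = to (E′≈ x) x∈E′
                        x∈D , x-ok = to (E≈ x) x∈E
                    in x∈D , x≢negm ∷ x-ok)
          (λ { (x∈D , x≢negm ∷ x-ok) → from (E′≈ x) (from (E≈ x) (x∈D , x-ok) , x≢negm) })

  eliminate : ∀ L {D l} → All DerivesUnit L → Derives S D →
              (∀ x → (x ∈ D × All (λ m → x ≢ neg m) L) ⇔ (x ≡ l)) → DerivesUnit l
  eliminate L uL d D-L≈l with strip L uL d
  ... | E , e , E≈ = E , e , λ x → mk⇔ (λ x∈E → to (D-L≈l x) (to (E≈ x) x∈E))
                                         (λ x≡l → from (E≈ x) (from (D-L≈l x) x≡l))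

PairClause : ∀ {n ℓ} → CNF n ℓ → Fin n → Fin n → Set
PairClause φ i j = ∃[ D ] (D ∈ φ × negLit j ∈ D × (∀ {x} → x ∈ D → x ≡ negLit i ⊎ x ≡ negLit j))

PairClauses : ∀ {n ℓ} → CNF n ℓ → Set
PairClauses {n} φ = ∀ (i j : Fin n) → i ≢ j → PairClause φ i j

pairs-force-AMO : ∀ {n ℓ} {φ : CNF n ℓ} → PairClauses φ →
                  ∀ α β → CNFSat (α ⊕ β) φ → AMO n α
pairs-force-AMO pairs α β sat i j αi αj with i ≟ j
... | yes i≡j = i≡j
... | no i≢j with pairs i j i≢j
... | D , D∈φ , _ , D⊆ij with find (All.lookup sat D∈φ)
...   | x , x∈D , x-true with D⊆ij x∈D
...     | inj₁ refl = ⊥-elim (not-¬ x-true αi)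
...     | inj₂ refl = ⊥-elim (not-¬ x-true αj)

atLeastOne : ∀ n {ℓ} → Clause (Var n ℓ)
atLeastOne n = map posLit (allFin n)

module Propagation {n ℓ} (φ : CNF n ℓ) (gs : List (Lit (Fin n))) where
  open UnitResolution _≟ᴸ_ (withUnits φ gs) public

  clause : ∀ {C} → C ∈ φ → Derives (withUnits φ gs) C
  clause C∈φ = axiom (AnyP.++⁺ˡ C∈φ)

  hypothesis : ∀ {g} → g ∈ gs → DerivesUnit (liftLit g)
  hypothesis g∈gs = unit-axiom (AnyP.++⁺ʳ φ (∈-map⁺ _ g∈gs))

  exclude : ∀ {i j} → PairClause φ i j → i ≢ j → DerivesUnit (posLit i) → DerivesUnit (negLit j)
  exclude {i} {j} (D , D∈φ , j∈D , D⊆ij) i≢j ui =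
    eliminate (posLit i ∷ []) (ui ∷ []) (clause D∈φ) λ x → mk⇔
      (λ { (x∈D , x≢negi ∷ []) → [ (λ x≡negi → ⊥-elim (x≢negi x≡negi)) , (λ x≡negj → x≡negj) ]′ (D⊆ij x∈D) })
      (λ { refl → j∈D , (λ negj≡negi → i≢j (sym (negLit-injective negj≡negi))) ∷ [] })

  select : ∀ {j} → atLeastOne n ∈ φ → (∀ k → k ≢ j → (k , false) ∈ gs) → DerivesUnit (posLit j)
  select {j} alo∈φ others-negated = eliminate (map negLit others) units (clause alo∈φ) only-j
    where
    others : List (Fin n)
    others = filter (λ k → ¬? (k ≟ j)) (allFin n)

    other : ∀ {k} → k ∈ others → k ≢ j
    other k∈ = proj₂ (∈-filter⁻ (λ k → ¬? (k ≟ j)) {xs = allFin n} k∈)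

    units : All DerivesUnit (map negLit others)
    units = AllP.map⁺ (tabulate λ k∈ → hypothesis (others-negated _ (other k∈)))

    forward : ∀ {x} → x ∈ atLeastOne n → All (λ m → x ≢ neg m) (map negLit others) → x ≡ posLit j
    forward x∈ x-ok with ∈-map⁻ posLit x∈
    ... | k , _ , refl with k ≟ j
    ...   | yes refl = refl
    ...   | no k≢j = ⊥-elim (All.lookup (AllP.map⁻ x-ok) (∈-filter⁺ (λ k → ¬? (k ≟ j)) (∈-allFin k) k≢j) refl)

    only-j : ∀ x → (x ∈ atLeastOne n × All (λ m → x ≢ neg m) (map negLit others)) ⇔ (x ≡ posLit j)
    only-j x = mk⇔ (uncurry forward) λ { refl →
      ∈-map⁺ posLit (∈-allFin j) ,
      AllP.map⁺ (tabulate λ k∈ eq → other k∈ (sym (posLit-injective eq))) }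

unitVec : ∀ {n} → Fin n → Fin n → Bool
unitVec i k = does (k ≟ i)

unitVec-self : ∀ {n} (i : Fin n) → unitVec i i ≡ true
unitVec-self i with i ≟ i
... | yes _ = refl
... | no i≢i = ⊥-elim (i≢i refl)

unitVec-other : ∀ {n} {i k : Fin n} → k ≢ i → unitVec i k ≡ false
unitVec-other {i = i} {k} k≢i with k ≟ i
... | yes k≡i = ⊥-elim (k≢i k≡i)
... | no _ = refl

unitVec-true : ∀ {n} {i k : Fin n} → unitVec i k ≡ true → k ≡ i
unitVec-true {i = i} {k} eq with k ≟ i
... | yes k≡i = k≡i

unitVec-AMO : ∀ {n} (i : Fin n) → AMO n (unitVec i)
unitVec-AMO i k k′ ek ek′ = trans (unitVec-true ek) (sym (unitVec-true ek′))

unitVec-EO : ∀ {n} (i : Fin n) → EO n (unitVec i)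
unitVec-EO i = unitVec-AMO i , i , unitVec-self i

unitVec-model : ∀ {n} (gs : List (Lit (Fin n))) (i : Fin n) → (i , false) ∉ gs →
                (∀ {k} → (k , true) ∈ gs → k ≡ i) → All (LitTrue (unitVec i)) gs
unitVec-model gs i negi∉ pos⇒i = tabulate literal-true
  where
  literal-true : ∀ {g} → g ∈ gs → LitTrue (unitVec i) g
  literal-true {k , true} g∈ rewrite pos⇒i g∈ = unitVec-self i
  literal-true {k , false} g∈ with k ≟ i
  ... | yes refl = ⊥-elim (negi∉ g∈)
  ... | no _ = refl

PropagationComplete : ∀ {n ℓ} → BoolFun n → CNF n ℓ → Set
PropagationComplete {n} f φ =
  ∀ (gs : List (Lit (Fin n))) (h : Lit (Fin n)) → gs ≢ [] →
  Entails f gs h → ⊢₁lit φ gs h ⊎ ⊢₁⊥ φ gs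

Positive : ∀ {n} → Lit (Fin n) → Set
Positive g = proj₂ g ≡ true

-- The remaining obligation: positive goals from purely negative hypotheses.
PositiveGoals : ∀ {n ℓ} → BoolFun n → CNF n ℓ → Set
PositiveGoals {n} f φ =
  ∀ (gs : List (Lit (Fin n))) (j : Fin n) → ¬ Any Positive gs →
  Entails f gs (j , true) → ⊢₁lit φ gs (j , true) ⊎ ⊢₁⊥ φ gs

module Completeness {n ℓ} {φ : CNF n ℓ} (f : BoolFun n) (pairs : PairClauses φ)
                    (f-unit : ∀ i → f (unitVec i)) (gs : List (Lit (Fin n))) (j : Fin n) where
  open Propagation φ gs

  Goal : Bool → Set
  Goal b = ⊢₁lit φ gs (j , b) ⊎ ⊢₁⊥ φ gs

  propagate : ∀ {i b} → (i , true) ∈ gs → unitVec i j ≡ b → Goal b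
  propagate {b = true} i∈gs eij =
    inj₁ (subst (λ k → DerivesUnit (posLit k)) (sym (unitVec-true eij)) (hypothesis i∈gs))
  propagate {i} {false} i∈gs eij = inj₁ (exclude (pairs i j i≢j) i≢j (hypothesis i∈gs))
    where
    i≢j : i ≢ j
    i≢j refl = not-¬ (unitVec-self i) eij

  -- A positive hypothesis xᵢ: ¬xᵢ or another xₖ is a conflict, otherwise
  -- eᵢ satisfies gs and so decides the goal.
  from-positive : ∀ {i b} → (i , true) ∈ gs → Entails f gs (j , b) → Goal b
  from-positive {i} i∈gs ent with (i , false) ∈ᴳ? gs
  ... | yes negi∈gs = inj₂ (conflict (hypothesis i∈gs) (hypothesis negi∈gs))
  ... | no negi∉gs with any? (λ g → (proj₂ g ≟ᴮ true) ×-dec ¬? (proj₁ g ≟ i)) gs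
  ...   | yes other with find other
  ...     | (k , _) , k∈gs , refl , k≢i =
            inj₂ (conflict (hypothesis k∈gs) (exclude (pairs i k (≢-sym k≢i)) (≢-sym k≢i) (hypothesis i∈gs)))
  from-positive {i} i∈gs ent | no negi∉gs | no no-other =
    propagate i∈gs (ent (unitVec i) (f-unit i) (unitVec-model gs i negi∉gs only-i))
    where
    only-i : ∀ {k} → (k , true) ∈ gs → k ≡ i
    only-i {k} k∈gs with k ≟ i
    ... | yes k≡i = k≡i
    ... | no k≢i = ⊥-elim (no-other (lose k∈gs (refl , k≢i)))

  -- Only negative hypotheses: a negative goal ¬xⱼ must be one of them (else
  -- eⱼ refutes it); positive goals are the remaining obligation.
  from-negatives : ∀ {b} → ¬ Any Positive gs → PositiveGoals f φ → Entails f gs (j , b) → Goal b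
  from-negatives {true} no-positive positive-goals ent = positive-goals gs j no-positive ent
  from-negatives {false} no-positive positive-goals ent with (j , false) ∈ᴳ? gs
  ... | yes negj∈gs = inj₁ (hypothesis negj∈gs)
  ... | no negj∉gs = ⊥-elim (not-¬ (unitVec-self j) (ent (unitVec j) (f-unit j)
          (unitVec-model gs j negj∉gs (λ k∈gs → ⊥-elim (no-positive (lose k∈gs refl))))))

pairwise-complete : ∀ {n ℓ} {φ : CNF n ℓ} (f : BoolFun n) → PairClauses φ →
                    (∀ i → f (unitVec i)) → PositiveGoals f φ → PropagationComplete f φ
pairwise-complete f pairs f-unit positive-goals gs (j , b) _ ent
  with any? (λ g → proj₂ g ≟ᴮ true) gs
... | no no-positive = from-negatives no-positive positive-goals ent
  where open Completeness f pairs f-unit gs j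
... | yes some-positive with find some-positive
...   | (i , _) , i∈gs , refl = from-positive i∈gs ent
  where open Completeness f pairs f-unit gs j

-- For AMO there are no such goals: the all-zero assignment refutes them.
AMO-positive-goals : ∀ {n ℓ} (φ : CNF n ℓ) → PositiveGoals (AMO n) φ
AMO-positive-goals φ gs j no-positive ent =
  ⊥-elim (not-¬ (ent (λ _ → false) (λ _ _ ()) (tabulate all-false)) refl)
  where
  all-false : ∀ {g} → g ∈ gs → LitTrue (λ _ → false) g
  all-false {k , true} g∈ = ⊥-elim (no-positive (lose g∈ refl))
  all-false {k , false} g∈ = refl

-- For EO, xⱼ is selected from x₁ ∨ … ∨ xₙ once all ¬xₖ (k ≠ j) are given;
-- if some ¬xₖ is missing, eₖ refutes the goal.
EO-positive-goals : ∀ {n ℓ} (φ : CNF n ℓ) → atLeastOne n ∈ φ → PositiveGoals (EO n) φ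
EO-positive-goals {n} φ alo∈φ gs j no-positive ent
  with all? (λ k → ¬? (k ≟ j) →-dec ((k , false) ∈ᴳ? gs))
... | yes others-negated = inj₁ (Propagation.select φ gs alo∈φ others-negated)
... | no ¬others-negated with ¬∀⟶∃¬ n _ (λ k → ¬? (k ≟ j) →-dec ((k , false) ∈ᴳ? gs)) ¬others-negated
...   | k , ¬[k≢j→negk∈gs] = ⊥-elim (not-¬ (unitVec-other (≢-sym k≢j)) ek-at-j)
  where
  k≢j : k ≢ j
  k≢j k≡j = ¬[k≢j→negk∈gs] (λ k≢j → ⊥-elim (k≢j k≡j))

  ek-at-j : unitVec k j ≡ true
  ek-at-j = ent (unitVec k) (unitVec-EO k)
    (unitVec-model gs k (λ negk∈gs → ¬[k≢j→negk∈gs] (λ _ → negk∈gs)) (λ k∈gs → ⊥-elim (no-positive (lose k∈gs refl))))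

negPair : ∀ {n ℓ} → Fin n → Fin n → Clause (Var n ℓ)
negPair i j = negLit i ∷ negLit j ∷ []

increasingPairs : ∀ n → List (Fin n × Fin n)
increasingPairs n = filter (λ p → proj₁ p <? proj₂ p) (cartesianProduct (allFin n) (allFin n))

amoClauses : ∀ n {ℓ} → CNF n ℓ
amoClauses n = map (uncurry negPair) (increasingPairs n)

eoClauses : ∀ n {ℓ} → CNF n ℓ
eoClauses n = atLeastOne n ∷ amoClauses n

amoClauses-member : ∀ {n ℓ} {C : Clause (Var n ℓ)} → C ∈ amoClauses n → ∃[ i ] ∃[ j ] (i ≢ j × C ≡ negPair i j)
amoClauses-member {n} C∈ with ∈-map⁻ (uncurry negPair) C∈
... | (i , j) , p∈ , refl = i , j , <⇒≢ (proj₂ (∈-filter⁻ (λ p → proj₁ p <? proj₂ p) {xs = cartesianProduct (allFin n) (allFin n)} p∈)) , refl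

negPair-∈ : ∀ {n ℓ} {i j : Fin n} → i < j → negPair {ℓ = ℓ} i j ∈ amoClauses n
negPair-∈ {i = i} {j} i<j =
  ∈-map⁺ (uncurry negPair) (∈-filter⁺ (λ p → proj₁ p <? proj₂ p) (∈-cartesianProduct⁺ (∈-allFin i) (∈-allFin j)) i<j)

amoClauses-pairs : ∀ {n ℓ} → PairClauses (amoClauses n {ℓ})
amoClauses-pairs i j i≢j with <-cmp i j
... | tri< i<j _ _ = negPair i j , negPair-∈ i<j , there (here refl) ,
      λ { (here refl) → inj₁ refl ; (there (here refl)) → inj₂ refl ; (there (there ())) }
... | tri≈ _ i≡j _ = ⊥-elim (i≢j i≡j)
... | tri> _ _ j<i = negPair j i , negPair-∈ j<i , here refl ,
      λ { (here refl) → inj₂ refl ; (there (here refl)) → inj₁ refl ; (there (there ())) }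

eoClauses-pairs : ∀ {n ℓ} → PairClauses (eoClauses n {ℓ})
eoClauses-pairs i j i≢j with amoClauses-pairs i j i≢j
... | D , D∈ , negj∈D , D⊆ij = D , there D∈ , negj∈D , D⊆ij

monochromatic : ∀ {V : Set} (b : Bool) (C : Clause V) → All (λ l → proj₂ l ≡ b) C → NoCompl C
monochromatic b C same l l∈C negl∈C = not-¬ refl (trans (All.lookup same l∈C) (sym (All.lookup same negl∈C)))

amoClauses-wellFormed : ∀ n {ℓ} → WellFormed (amoClauses n {ℓ})
amoClauses-wellFormed n = tabulate λ C∈ → negative (amoClauses-member C∈)
  where
  negative : ∀ {C} → ∃[ i ] ∃[ j ] (i ≢ j × C ≡ negPair i j) → NoCompl C
  negative (i , j , _ , refl) = monochromatic false _ (refl ∷ refl ∷ [])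

eoClauses-wellFormed : ∀ n {ℓ} → WellFormed (eoClauses n {ℓ})
eoClauses-wellFormed n = monochromatic true _ (AllP.map⁺ (tabulate λ _ → refl)) ∷ amoClauses-wellFormed n

amoClauses-satisfied : ∀ {n ℓ} (α : Fin n → Bool) (β : Fin ℓ → Bool) → AMO n α → CNFSat (α ⊕ β) (amoClauses n)
amoClauses-satisfied α β amo = tabulate λ C∈ → pair-satisfied (amoClauses-member C∈)
  where
  pair-satisfied : ∀ {C} → ∃[ i ] ∃[ j ] (i ≢ j × C ≡ negPair i j) → ClauseSat (α ⊕ β) C
  pair-satisfied (i , j , i≢j , refl) with α i in αi | α j in αj
  ... | false | _ = here αi
  ... | true | false = there (here αj)
  ... | true | true = ⊥-elim (i≢j (amo i j αi αj))

AMO-encoding : ∀ n {ℓ} → IsEncoding (AMO n) (amoClauses n {ℓ})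
AMO-encoding n α = mk⇔ (λ amo → (λ _ → false) , amoClauses-satisfied α _ amo)
                       (λ (β , sat) → pairs-force-AMO amoClauses-pairs α β sat)

EO-encoding : ∀ n {ℓ} → IsEncoding (EO n) (eoClauses n {ℓ})
EO-encoding n α = mk⇔
  (λ (amo , k , αk) → (λ _ → false) , AnyP.map⁺ (lose (∈-allFin k) αk) ∷ amoClauses-satisfied α _ amo)
  (λ { (β , alo ∷ sat) → pairs-force-AMO amoClauses-pairs α β sat , satisfied (AnyP.map⁻ alo) })

AMO-PC : ∀ n {ℓ} → IsPCEncoding (AMO n) (amoClauses n {ℓ})
AMO-PC n = AMO-encoding n , pairwise-complete (AMO n) amoClauses-pairs unitVec-AMO (AMO-positive-goals _)

EO-PC : ∀ n {ℓ} → IsPCEncoding (EO n) (eoClauses n {ℓ})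
EO-PC n = EO-encoding n , pairwise-complete (EO n) eoClauses-pairs unitVec-EO (EO-positive-goals _ (here refl))

AMO-P : ∀ n {ℓ} → IsPEncoding (amoClauses n {ℓ})
AMO-P n = (λ i → unitVec i ⊕ (λ _ → false) , amoClauses-satisfied _ _ (unitVec-AMO i) , unitVec-self i) ,
          (λ i j i≢j → Propagation.exclude (amoClauses n) ((i , true) ∷ []) (amoClauses-pairs i j i≢j) i≢j
                         (Propagation.hypothesis (amoClauses n) _ (here refl)))

assign : ∀ {n ℓ} → (Var n ℓ → Bool) → Fin n → Bool → Var n ℓ → Bool
assign a j b = updateAt (λ k → a (inj₁ k)) j (λ _ → b) ⊕ (λ y → a (inj₂ y))

assign-elsewhere : ∀ {n ℓ} (a : Var n ℓ → Bool) j b v → v ≢ inj₁ j → assign a j b v ≡ a v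
assign-elsewhere a j b (inj₁ k) v≢j = updateAt-minimal k j _ (λ k≡j → v≢j (cong inj₁ k≡j))
assign-elsewhere a j b (inj₂ y) _ = refl

lower-zero : ∀ {n} (α : Fin n → Bool) i → (∀ k → k ≢ i → α k ≡ false) →
             ∀ k → updateAt α i (λ _ → false) k ≡ false
lower-zero α i α-zero k with k ≟ i
... | yes refl = updateAt-updates i α
... | no k≢i = trans (updateAt-minimal k i α k≢i) (α-zero k k≢i)

falsified-clause : ∀ {n ℓ} (φ : CNF n ℓ) (a a′ : Var n ℓ → Bool) (v : Var n ℓ) →
                   (∀ w → w ≢ v → a′ w ≡ a w) → CNFSat a φ → ¬ CNFSat a′ φ →
                   ∃[ C ] (C ∈ φ × (v , a v) ∈ C × (∀ {l} → l ∈ C → ¬ LitTrue a′ l))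
falsified-clause φ a a′ v agree sat ¬sat′
  with find (¬All⇒Any¬ (λ C → any? (λ l → a′ (proj₁ l) ≟ᴮ proj₂ l) C) φ ¬sat′)
... | C , C∈φ , C-false with find (All.lookup sat C∈φ)
...   | (w , b) , l∈C , aw≡b with w ≟ⱽ v
...     | yes refl = C , C∈φ , subst (λ c → (v , c) ∈ C) (sym aw≡b) l∈C , λ l∈ l-true → C-false (lose l∈ l-true)
...     | no w≢v = ⊥-elim (C-false (lose l∈C (trans (agree w w≢v) aw≡b)))

Blocking : ∀ {n ℓ} → CNF n ℓ → Fin n → Fin n → Set
Blocking φ i j = ∃[ C ] (C ∈ φ × negLit j ∈ C × (∀ k → k ≢ i → k ≢ j → negLit k ∉ C))

blocking-clause : ∀ {n ℓ} {φ : CNF n ℓ} (a : Var n ℓ → Bool) {i j} → CNFSat a φ →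
                  (∀ k → k ≢ i → a (inj₁ k) ≡ false) → i ≢ j → ¬ CNFSat (assign a j true) φ → Blocking φ i j
blocking-clause {φ = φ} a {i} {j} sat a-zero i≢j ¬sat′
  with falsified-clause φ a (assign a j true) (inj₁ j) (assign-elsewhere a j true) sat ¬sat′
... | C , C∈φ , aj∈C , C-false =
  C , C∈φ , subst (λ c → (inj₁ j , c) ∈ C) (a-zero j (≢-sym i≢j)) aj∈C ,
  λ k k≢i k≢j negk∈C → C-false negk∈C
    (trans (assign-elsewhere a j true (inj₁ k) (λ eq → k≢j (SumP.inj₁-injective eq))) (a-zero k k≢i))

NoNegativeInput HasNegativeInput : ∀ {n ℓ} → Clause (Var n ℓ) → Set
NoNegativeInput {n} C = ∀ (k : Fin n) → negLit k ∉ C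
HasNegativeInput {n} C = ∃[ k ] (negLit {n} k ∈ C)

positive-clause : ∀ {n ℓ} {φ : CNF n ℓ} (a : Var n ℓ → Bool) {i} → CNFSat a φ →
                  (∀ k → k ≢ i → a (inj₁ k) ≡ false) → ¬ CNFSat (assign a i false) φ →
                  ∃[ C ] (C ∈ φ × NoNegativeInput C)
positive-clause {φ = φ} a {i} sat a-zero ¬sat′
  with falsified-clause φ a (assign a i false) (inj₁ i) (assign-elsewhere a i false) sat ¬sat′
... | C , C∈φ , _ , C-false = C , C∈φ , λ k negk∈C → C-false negk∈C (lower-zero _ i a-zero k)

encoding-blocking : ∀ {n ℓ} {φ : CNF n ℓ} (f : BoolFun n) → IsEncoding f φ → (∀ i → f (unitVec i)) →
                    (∀ α → f α → AMO n α) → ∀ i j → i ≢ j → Blocking φ i j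
encoding-blocking f enc f-unit f-AMO i j i≢j with to (enc (unitVec i)) (f-unit i)
... | β , sat = blocking-clause (unitVec i ⊕ β) sat (λ k → unitVec-other) i≢j
  λ sat′ → i≢j (f-AMO raised (from (enc raised) (β , sat′)) i j
                 (trans (updateAt-minimal i j _ i≢j) (unitVec-self i)) (updateAt-updates j _))
  where
  raised : Fin _ → Bool
  raised = updateAt (unitVec i) j (λ _ → true)

-- In an encoding of EO, lowering the single one of eᵢ violates some clause
-- without negative input literal.
EO-positive-clause : ∀ {n ℓ} {φ : CNF n ℓ} → IsEncoding (EO n) φ → Fin n → ∃[ C ] (C ∈ φ × NoNegativeInput C)
EO-positive-clause enc i with to (enc (unitVec i)) (unitVec-EO i)
... | β , sat = positive-clause (unitVec i ⊕ β) sat (λ k → unitVec-other) λ sat′ →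
  let k , raised-k = proj₂ (from (enc lowered) (β , sat′))
  in not-¬ (lower-zero (unitVec i) i (λ k → unitVec-other) k) raised-k
  where
  lowered : Fin _ → Bool
  lowered = updateAt (unitVec i) i (λ _ → false)

-- In a P-encoding, a model with xᵢ = 1 is eᵢ on the inputs, and raising xⱼ
-- breaks it by soundness of unit propagation; so blocking clauses exist too.
P-blocking : ∀ {n ℓ} {φ : CNF n ℓ} → IsPEncoding φ → ∀ i j → i ≢ j → Blocking φ i j
P-blocking {φ = φ} (models , excludes) i j i≢j with models i
... | a , sat , ai = blocking-clause a sat a-zero i≢j ¬sat′
  where
  a-zero : ∀ k → k ≢ i → a (inj₁ k) ≡ false
  a-zero k k≢i = sound-⊢₁ a φ _ (k , false) sat (ai ∷ []) (excludes i k (≢-sym k≢i))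

  ¬sat′ : ¬ CNFSat (assign a j true) φ
  ¬sat′ sat′ = not-¬ (updateAt-updates j _)
    (sound-⊢₁ (assign a j true) φ _ (j , false) sat′
       (trans (assign-elsewhere a j true (inj₁ i) (λ eq → i≢j (SumP.inj₁-injective eq))) ai ∷ []) (excludes i j i≢j))

lookup-injective : ∀ {A : Set} {xs : List A} → Unique xs → Injective _≡_ _≡_ (lookup xs)
lookup-injective {xs = x ∷ xs} (x∉xs ∷ u) {zero} {zero} _ = refl
lookup-injective {xs = x ∷ xs} (x∉xs ∷ u) {zero} {suc j} eq = ⊥-elim (All.lookup x∉xs (∈-lookup j) eq)
lookup-injective {xs = x ∷ xs} (x∉xs ∷ u) {suc i} {zero} eq = ⊥-elim (All.lookup x∉xs (∈-lookup i) (sym eq))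
lookup-injective {xs = x ∷ xs} (x∉xs ∷ u) {suc i} {suc j} eq = cong suc (lookup-injective u eq)

distinct-members : ∀ {A : Set} {xs ys : List A} → Unique ys → All (_∈ xs) ys → length ys ≤ length xs
distinct-members {xs = xs} {ys} u ys⊆xs = injective⇒≤ {f = position} λ {i} {j} same →
  lookup-injective u (trans (AnyP.lookup-index (member i))
                     (trans (cong (lookup xs) same) (sym (AnyP.lookup-index (member j)))))
  where
  member : ∀ i → lookup ys i ∈ xs
  member i = All.lookup ys⊆xs (∈-lookup i)

  position : Fin (length ys) → Fin (length xs)
  position i = Any.index (member i)

NegativeClauses : ∀ {n ℓ} → CNF n ℓ → ℕ → Set
NegativeClauses {n} {ℓ} φ k =
  ∃[ Cs ] (length Cs ≡ k × Unique Cs × All (_∈ φ) Cs × All (HasNegativeInput {n} {ℓ}) Cs)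

negative-bound : ∀ {n ℓ k} {φ : CNF n ℓ} → NegativeClauses φ k → k ≤ size φ
negative-bound (Cs , refl , distinct , Cs⊆φ , _) = distinct-members distinct Cs⊆φ

-- A clause without negative input literal differs from all of them.
negative+positive-bound : ∀ {n ℓ k} {φ : CNF n ℓ} → NegativeClauses φ k →
                          ∃[ D ] (D ∈ φ × NoNegativeInput D) → suc k ≤ size φ
negative+positive-bound (Cs , refl , distinct , Cs⊆φ , negative) (D , D∈φ , no-negative) =
  distinct-members (All.map (λ { (k , negk∈C) refl → no-negative k negk∈C }) negative ∷ distinct) (D∈φ ∷ Cs⊆φ)

one-negative : ∀ {n ℓ} {φ : CNF n ℓ} {i j} → Blocking φ i j → NegativeClauses φ 1
one-negative {j = j} (C , C∈φ , negj∈C , _) = C ∷ [] , refl , [] ∷ [] , C∈φ ∷ [] , (j , negj∈C) ∷ []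

x₀ x₁ x₂ : ∀ {n} → Fin (suc (suc (suc n)))
x₀ = zero
x₁ = suc zero
x₂ = suc (suc zero)

-- With at least three inputs, the blocking clauses for (2,0), (0,1), (1,2)
-- are distinct: each contains the negative literal the previous one avoids.
three-negative : ∀ {n ℓ} {φ : CNF (suc (suc (suc n))) ℓ} →
                 (∀ i j → i ≢ j → Blocking φ i j) → NegativeClauses φ 3
three-negative blocking
  with blocking x₂ x₀ (λ ()) | blocking x₀ x₁ (λ ()) | blocking x₁ x₂ (λ ())
... | C₀ , C₀∈φ , negx₀∈C₀ , C₀-avoids | C₁ , C₁∈φ , negx₁∈C₁ , C₁-avoids | C₂ , C₂∈φ , negx₂∈C₂ , C₂-avoids =
  C₀ ∷ C₁ ∷ C₂ ∷ [] , refl ,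
  (C₀≢C₁ ∷ C₀≢C₂ ∷ []) ∷ (C₁≢C₂ ∷ []) ∷ [] ∷ [] ,
  C₀∈φ ∷ C₁∈φ ∷ C₂∈φ ∷ [] ,
  (x₀ , negx₀∈C₀) ∷ (x₁ , negx₁∈C₁) ∷ (x₂ , negx₂∈C₂) ∷ []
  where
  C₀≢C₁ : C₀ ≢ C₁
  C₀≢C₁ refl = C₀-avoids x₁ (λ ()) (λ ()) negx₁∈C₁
  C₀≢C₂ : C₀ ≢ C₂
  C₀≢C₂ refl = C₂-avoids x₀ (λ ()) (λ ()) negx₀∈C₀
  C₁≢C₂ : C₁ ≢ C₂
  C₁≢C₂ refl = C₁-avoids x₂ (λ ()) (λ ()) negx₂∈C₂

AMO-blocking : ∀ {n ℓ} {φ : CNF n ℓ} → IsPCEncoding (AMO n) φ → ∀ i j → i ≢ j → Blocking φ i j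
AMO-blocking (enc , _) = encoding-blocking _ enc unitVec-AMO (λ _ amo → amo)

EO-blocking : ∀ {n ℓ} {φ : CNF n ℓ} → IsPCEncoding (EO n) φ → ∀ i j → i ≢ j → Blocking φ i j
EO-blocking (enc , _) = encoding-blocking _ enc unitVec-EO (λ _ → proj₁)

lemma14 : A-is 2 1 × E-is 2 2 × S-is 2 1 × A-is 3 3 × E-is 3 4 × S-is 3 3
lemma14 =
  ((0 , amoClauses 2 , amoClauses-wellFormed 2 , AMO-PC 2 , refl) ,
   λ _ _ _ pc → negative-bound (one-negative (AMO-blocking pc zero (suc zero) (λ ())))) ,
  ((0 , eoClauses 2 , eoClauses-wellFormed 2 , EO-PC 2 , refl) ,
   λ _ _ _ pc → negative+positive-bound (one-negative (EO-blocking pc zero (suc zero) (λ ())))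
                                        (EO-positive-clause (proj₁ pc) zero)) ,
  ((0 , amoClauses 2 , amoClauses-wellFormed 2 , AMO-P 2 , refl) ,
   λ _ _ _ pe → negative-bound (one-negative (P-blocking pe zero (suc zero) (λ ())))) ,
  ((0 , amoClauses 3 , amoClauses-wellFormed 3 , AMO-PC 3 , refl) ,
   λ _ _ _ pc → negative-bound (three-negative (AMO-blocking pc))) ,
  ((0 , eoClauses 3 , eoClauses-wellFormed 3 , EO-PC 3 , refl) ,
   λ _ _ _ pc → negative+positive-bound (three-negative (EO-blocking pc)) (EO-positive-clause (proj₁ pc) zero)) ,
  ((0 , amoClauses 3 , amoClauses-wellFormed 3 , AMO-P 3 , refl) ,
   λ _ _ _ pe → negative-bound (three-negative (P-blocking pe)))
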